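{- Let $a,b$ be coprime positive integers with $b>1$, and let $D$ be a $0$-stable chip configuration. (a) $D$ is $(b-1)$-skeletal (superstable) if and only if $\mathrm{lpath}(D)$ is a labeled $(a,b)$-Dyck path. (b) $D$ is $0$-skeletal if and only if $\widehat{\mathrm{lpath}(D)}$ is a labeled inverted $(a,b)$-Dyck path. (c) The map $D\mapsto D'$ with $D'(i)=a-e-D(i)$ for $i\in[b]$, where $e=1+\lfloor a/b\rfloor$, is a bijection from superstable configurations to $0$-skeletal configurations.
   Context: Write $[b]=\{1,\dots,b\}$. A chip configuration is $D:[b]\to\mathbb{Z}$; $D\ge0$ means all values nonnegative. For $S\subseteq[b]$ with $|S|=s$, $\phi_S$ subtracts $1+\lfloor (b-s)a/b\rfloor$ from $D(i)$ for $i\in S$ and adds $\lfloor sa/b\rfloor$ to $D(j)$ for $j\in[b]\setminus S$; $\beta_S=\phi_S^{ -1}$; for $D\ge0$ these are legal if the result is $\ge0$. For $0\le k<b$: a $k$-firing move is $\phi_S$ with $0<|S|\le k+1$; $D\ge0$ is $k$-stable if no $k$-firing move is legal on it; superstable means $(b-1)$-stable; $D$ is $k$-skeletal if $k$-stable and for every nonempty $T$ with $\beta_T$ legal on $D$, $\beta_T(D)$ is not $k$-stable. $\mathrm{lpath}(D)$ for $D\ge0$: $i$ is poorer than $j$ if $D(i)<D(j)$ or ($D(i)=D(j)$ and $i<j$); with $w_1,\dots,w_b$ the vertices from poorest to richest and $x_t=D(w_t)$, $\mathrm{lpath}(D)$ is the path from $(0,0)$ having a north step from $(x_t,t-1)$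 to $(x_t,t)$ labeled $w_t$ for each $t$, joined by east steps, ending with east steps from $(x_b,b)$ to $(a,b)$. The level of $(x,y)$ is $ay-bx$. A labeled $(a,b)$-Dyck path is such a labeled path from $(0,0)$ to $(a,b)$ (labels increasing bottom to top within each maximal run of north steps) all of whose north steps start at level $\ge0$. For a $0$-stable $D$, $\mathrm{lpath}(D)$ ends with at least $e=1+\lfloor a/b\rfloor$ east steps, and $\widehat{\mathrm{lpath}(D)}$ is the labeled path from $(-e,0)$ to $(a-e,b)$ obtained by moving its last $e$ east steps to the beginning. A labeled inverted $(a,b)$-Dyck path is a labeled lattice path from $(-e,0)$ to $(a-e,b)$ staying in the closed triangle with vertices $(-e,0)$, $(a-e,0)$, $(a-e,b)$. -}

module Defs where

open import Data.Bool using (Bool; true; false; if_then_else_; _∧_; _∨_)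
open import Data.Nat as ℕ using (ℕ; zero; suc; _∸_)
open import Data.Nat.DivMod using (_/_)
open import Data.Integer as ℤ using (ℤ; +_; -_; _-_; _+_; _*_; _≤_)
open import Data.Fin as Fin using (Fin)
open import Data.Fin.Subset using (Subset; ∣_∣)
open import Data.Vec using (lookup)
open import Data.List using (List; []; _∷_; _++_; replicate; foldr; allFin; length; take; map)
open import Data.List.Relation.Unary.All using (All)
open import Data.List.Relation.Binary.Permutation.Propositional using (_↭_)
open import Data.Product using (_×_; _,_)
open import Data.Unit using (⊤)
open import Relation.Nullary using (¬_; does)
open import Relation.Binary.PropositionalEquality using (_≡_)

-- Floor division ⌊ n / m ⌋ (only used with m = b > 1; value for m = 0 irrelevant)
fl : ℕ → ℕ → ℕ
fl n zero    = 0
fl n (suc m) = n / suc m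

Config : ℕ → Set
Config b = Fin b → ℤ

NonNeg : ∀ {b} → Config b → Set
NonNeg D = ∀ i → + 0 ≤ D i

φ : (a b : ℕ) → Subset b → Config b → Config b
φ a b S D i =
  if lookup S i then D i - + (1 ℕ.+ fl ((b ∸ ∣ S ∣) ℕ.* a) b)
                else D i + + fl (∣ S ∣ ℕ.* a) b

β : (a b : ℕ) → Subset b → Config b → Config b
β a b S D i =
  if lookup S i then D i + + (1 ℕ.+ fl ((b ∸ ∣ S ∣) ℕ.* a) b)
                else D i - + fl (∣ S ∣ ℕ.* a) b

-- k-stable: D ≥ 0 and no k-firing move (φ_S with 0 < |S| ≤ k+1) is legal
Stable : (a b k : ℕ) → Config b → Set
Stable a b k D =
  NonNeg D × (∀ (S : Subset b) → 0 ℕ.< ∣ S ∣ → ∣ S ∣ ℕ.≤ suc k → ¬ NonNeg (φ a b S D))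

Superstable : (a b : ℕ) → Config b → Set
Superstable a b = Stable a b (b ∸ 1)

Skeletal : (a b k : ℕ) → Config b → Set
Skeletal a b k D =
  Stable a b k D ×
  (∀ (T : Subset b) → 0 ℕ.< ∣ T ∣ → NonNeg (β a b T D) → ¬ Stable a b k (β a b T D))

data Step (b : ℕ) : Set where
  E : Step b
  N : Fin b → Step b

poorer : ∀ {b} → Config b → Fin b → Fin b → Bool
poorer D i j = does (D i ℤ.<? D j) ∨ (does (D i ℤ.≟ D j) ∧ does (i Fin.<? j))

insertBy : ∀ {b} → (Fin b → Fin b → Bool) → Fin b → List (Fin b) → List (Fin b)
insertBy p x []       = x ∷ []
insertBy p x (y ∷ ys) = if p x y then x ∷ y ∷ ys else y ∷ insertBy p x ys

sortedVertices : ∀ {b} → Config b → List (Fin b)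
sortedVertices {b} D = foldr (insertBy (poorer D)) [] (allFin b)

-- lpath(D) (for D ≥ 0, x_t = D(w_t) as a natural number)
lpathFrom : ∀ {b} → (a : ℕ) → Config b → ℕ → List (Fin b) → List (Step b)
lpathFrom a D cur []       = replicate (a ∸ cur) E
lpathFrom a D cur (w ∷ ws) =
  replicate (ℤ.∣ D w ∣ ∸ cur) E ++ (N w ∷ lpathFrom a D ℤ.∣ D w ∣ ws)

lpath : ∀ {b} → (a : ℕ) → Config b → List (Step b)
lpath a D = lpathFrom a D 0 (sortedVertices D)

eOf : (a b : ℕ) → ℕ
eOf a b = 1 ℕ.+ fl a b

-- move the last e steps (east steps, for 0-stable D) to the beginning
hat : ∀ {b} → ℕ → List (Step b) → List (Step b)
hat e P = replicate e E ++ take (length P ∸ e) P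

labels : ∀ {b} → List (Step b) → List (Fin b)
labels []        = []
labels (E ∷ P)   = labels P
labels (N i ∷ P) = i ∷ labels P

countE : ∀ {b} → List (Step b) → ℕ
countE []        = 0
countE (E ∷ P)   = suc (countE P)
countE (N _ ∷ P) = countE P

IncRuns : ∀ {b} → List (Step b) → Set
IncRuns []                = ⊤
IncRuns (E ∷ P)           = IncRuns P
IncRuns (N i ∷ [])        = ⊤
IncRuns (N i ∷ E ∷ P)     = IncRuns P
IncRuns (N i ∷ N j ∷ P)   = (i Fin.< j) × IncRuns (N j ∷ P)

LabeledPath : (a b : ℕ) → List (Step b) → Set
LabeledPath a b P = (countE P ≡ a) × (labels P ↭ allFin b) × IncRuns P

Point : Set
Point = ℤ × ℤ

vertices : ∀ {b} → Point → List (Step b) → List Point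
vertices p         []        = p ∷ []
vertices (x , y)   (E ∷ P)   = (x , y) ∷ vertices (x + + 1 , y) P
vertices (x , y)   (N _ ∷ P) = (x , y) ∷ vertices (x , y + + 1) P

northStarts : ∀ {b} → Point → List (Step b) → List Point
northStarts p         []        = []
northStarts (x , y)   (E ∷ P)   = northStarts (x + + 1 , y) P
northStarts (x , y)   (N _ ∷ P) = (x , y) ∷ northStarts (x , y + + 1) P

level : (a b : ℕ) → Point → ℤ
level a b (x , y) = + a * y - + b * x

IsLabeledDyck : (a b : ℕ) → List (Step b) → Set
IsLabeledDyck a b P =
  LabeledPath a b P × All (λ p → + 0 ≤ level a b p) (northStarts (+ 0 , + 0) P)

-- closed triangle with vertices (-e,0), (a-e,0), (a-e,b)
InTriangle : (a b e : ℕ) → Point → Set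
InTriangle a b e (x , y) =
  (+ 0 ≤ y) × (x ≤ + a - + e) × (+ a * y ≤ + b * (x + + e))

IsLabeledInvDyck : (a b : ℕ) → List (Step b) → Set
IsLabeledInvDyck a b P =
  LabeledPath a b P ×
  All (InTriangle a b (eOf a b)) (vertices (- + eOf a b , + 0) P)

flipConfig : (a b : ℕ) → Config b → Config b
flipConfig a b D i = + a - + eOf a b - D i

{-# OPTIONS --safe #-}
module Submission where

-- Write c t = ⌊t a / b⌋ and M = c (b − 1).  Firing S is legal iff every vertex of S holds more than
-- c (b − |S|) chips, so D is 0-stable iff 0 ≤ D ≤ M, and D is superstable iff for every p < b more
-- than p vertices hold at most c p chips.  Borrowing on T keeps D 0-stable iff the vertices of T hold
-- at most M − 1 − c (b − |T|) chips and the others at least c |T|; by superadditivity of c, a 0-stable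
-- D is therefore 0-skeletal iff for every 0 < s ≤ b fewer than s vertices hold at most
-- M − 1 − c (b − s) chips.  If w₀, …, w_{b−1} are the vertices from poorest to richest, the two count
-- conditions at p amount to D (w_p) ≤ c p and D (w_p) ≥ M − c (b − 1 − p): the Dyck condition at the
-- p-th north step of lpath D, and (as M + e = a by coprimality) the triangle condition at the top of
-- that step.  Finally x ↦ M − x turns "at most c p" into the complement of "at most M − 1 − c p",
-- exchanging the two count conditions, which gives (c).

open import Defs
open import Data.Bool using (true; false; not)
open import Data.Empty using (⊥-elim)
open import Data.Fin as Fin using (Fin; fromℕ<)
import Data.Fin.Properties as FP
open import Data.Fin.Subset using (Subset; ∣_∣; _∈_; _∉_; _⊆_; ∁; Nonempty; ⁅_⁆)
open import Data.Fin.Subset.Properties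
  using (_∈?_; x∉p⇒x∈∁p; x∈∁p⇒x∉p; nonempty?; Empty-unique; ∣⊥∣≡0; ∣⁅x⁆∣≡1; x∈⁅y⁆⇒x≡y; ∣∁p∣≡n∸∣p∣;
         ∣p∣≤n; p⊆q⇒∣p∣≤∣q∣; p⊂q⇒∣p∣<∣q∣; ∣p∣≡n⇒p≡⊤; ∈⊤)
open import Data.Integer as ℤ using (ℤ; +_; -_)
import Data.Integer.Properties as ZP
import Data.Integer.Tactic.RingSolver as ℤ-Solver
open import Data.List as List using (List; []; _∷_; _++_; length; filter; allFin; foldr; replicate; take)
open import Data.List.Membership.Propositional.Properties using (∈-lookup)
open import Data.List.Properties
  using (filter-none; length-tabulate; length-++; length-replicate; ++-identityʳ; ++-assoc)
open import Data.List.Relation.Binary.Permutation.Propositional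
  using (_↭_; ↭-refl; ↭-prep; ↭-swap; ↭-trans; ↭-sym)
open import Data.List.Relation.Binary.Permutation.Propositional.Properties using (All-resp-↭; ↭-length; filter-↭)
open import Data.List.Relation.Unary.All as All using (All; []; _∷_)
open import Data.List.Relation.Unary.AllPairs using (AllPairs; []; _∷_)
open import Data.List.Relation.Unary.Unique.Propositional using (Unique)
open import Data.List.Relation.Unary.Unique.Propositional.Properties using (allFin⁺)
open import Data.Nat as ℕ using (ℕ; zero; suc; _+_; _*_; _∸_; _≤_; _<_; z≤n; s≤s; _≤?_)
open import Data.Nat.Properties
open import Data.Nat.Coprimality using (Coprime)
open import Data.Nat.Divisibility using (m%n≡0⇒n∣m; ∣-refl)
open import Data.Nat.DivMod using (_/_; _%_; m/n*n≤m; m*n/n≡m; /-monoˡ-≤; m≡m%n+[m/n]*n; m%n<n)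
open import Data.Nat.Tactic.RingSolver using (solve-∀)
open import Data.Product using (_×_; _,_; proj₁; proj₂; Σ)
open import Data.Product.Relation.Binary.Lex.Strict using (×-decidable; ×-strictTotalOrder)
open import Data.Sum using (inj₁; inj₂)
open import Data.Unit using (⊤; tt)
open import Data.Vec using (lookup; tabulate)
open import Data.Vec.Properties using (lookup∘tabulate; lookup⇒[]=; []=⇒lookup; tabulate-cong; tabulate-∘)
open import Function using (_∘_)
open import Function.Bundles using (_⇔_; mk⇔; Equivalence)
open import Function.Construct.Composition using (_⇔-∘_)
open import Function.Construct.Symmetry using (⇔-sym)
open import Function.Properties.Equivalence using (⇔-setoid)
open import Function.Related.TypeIsomorphisms using (¬-cong-⇔)
open import Level using (Level; 0ℓ)
open import Relation.Binary using (Rel; Decidable; Transitive; StrictTotalOrder; tri<; tri≈; tri>)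
open import Relation.Binary.PropositionalEquality
import Relation.Binary.Reasoning.Setoid as SetoidReasoning
open import Relation.Nullary using (¬_; yes; no; does; contradiction; ¬?)
open import Relation.Nullary.Decidable using (dec-true; does-⇔)
open import Relation.Unary using (Pred) renaming (Decidable to Decidable₁)

private
  variable
    ℓ ℓ′ : Level

module ⇔-Reasoning = SetoidReasoning (⇔-setoid 0ℓ)

+m-+k≡+[m∸k] : ∀ {m k} → k ≤ m → + m ℤ.- + k ≡ + (m ∸ k)
+m-+k≡+[m∸k] {m} {k} k≤m = trans (ZP.m-n≡m⊖n m k) (ZP.⊖-≥ k≤m)

0≤+m-+k⇔k≤m : ∀ {m k} → + 0 ℤ.≤ + m ℤ.- + k ⇔ k ≤ m
0≤+m-+k⇔k≤m = mk⇔ (ZP.drop‿+≤+ ∘ ZP.0≤i-j⇒j≤i) (ZP.i≤j⇒0≤j-i ∘ ℤ.+≤+)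

≰+suc⇔≥+ : ∀ {x t m} → (¬ x + suc t ≤ m) ⇔ m ≤ x + t
≰+suc⇔≥+ {x} {t} {m} = mk⇔ (λ ≰ → ≤-pred (subst (m <_) (+-suc x t) (≰⇒> ≰)))
                           (λ ≥ ≤ → <⇒≱ (subst (_≤ m) (+-suc x t) ≤) ≥)

∸≤⇔≤+ : ∀ {m y t} → m ∸ y ≤ t ⇔ m ≤ y + t
∸≤⇔≤+ {m} {y} = mk⇔ (λ m∸y≤t → ≤-trans (m≤n+m∸n m y) (+-monoʳ-≤ y m∸y≤t)) (m≤n+o⇒m∸n≤o m y)

≰+suc⇔∸≤ : ∀ {x t m} → (¬ x + suc t ≤ m) ⇔ m ∸ x ≤ t
≰+suc⇔∸≤ = mk⇔ (Equivalence.from ∸≤⇔≤+ ∘ Equivalence.to ≰+suc⇔≥+)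
               (Equivalence.from ≰+suc⇔≥+ ∘ Equivalence.to ∸≤⇔≤+)

downward-induction : ∀ (P : ℕ → Set ℓ) {m n} → P n → (∀ {p} → m ≤ p → p < n → P (suc p) → P p) →
                     ∀ {p} → m ≤ p → p ≤ n → P p
downward-induction P {m} {n} Pn step m≤p p≤n = go _ m≤p (m∸n+n≡m p≤n)
  where
    go : ∀ k {p} → m ≤ p → k + p ≡ n → P p
    go zero    _   refl  = Pn
    go (suc k) {p} m≤p k+p≡n =
      step m≤p (subst (p <_) k+p≡n (s≤s (m≤n+m p k))) (go k (m≤n⇒m≤1+n m≤p) (trans (+-suc k p) k+p≡n))

module InsertionSort {b} {_≺_ : Rel (Fin b) ℓ} (_≺?_ : Decidable _≺_)
  (≺-trans : Transitive _≺_) (≺-connex : ∀ {x y} → x ≢ y → ¬ x ≺ y → y ≺ x) where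

  insert : Fin b → List (Fin b) → List (Fin b)
  insert = insertBy (λ x y → does (x ≺? y))

  insert-↭ : ∀ x ys → insert x ys ↭ x ∷ ys
  insert-↭ x []       = ↭-refl
  insert-↭ x (y ∷ ys) with x ≺? y
  ... | yes _ = ↭-refl
  ... | no  _ = ↭-trans (↭-prep y (insert-↭ x ys)) (↭-swap y x ↭-refl)

  insert-sorted : ∀ x ys → All (x ≢_) ys → AllPairs _≺_ ys → AllPairs _≺_ (insert x ys)
  insert-sorted x []       _              _             = [] ∷ []
  insert-sorted x (y ∷ ys) (x≢y ∷ x∉ys) (y≺ys ∷ ys↑) with x ≺? y
  ... | yes x≺y = (x≺y ∷ All.map (≺-trans x≺y) y≺ys) ∷ y≺ys ∷ ys↑
  ... | no  x⊀y =
    All-resp-↭ (↭-sym (insert-↭ x ys)) (≺-connex x≢y x⊀y ∷ y≺ys) ∷ insert-sorted x ys x∉ys ys↑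

  sort : List (Fin b) → List (Fin b)
  sort = foldr insert []

  sort-↭ : ∀ xs → sort xs ↭ xs
  sort-↭ []       = ↭-refl
  sort-↭ (x ∷ xs) = ↭-trans (insert-↭ x (sort xs)) (↭-prep x (sort-↭ xs))

  sort-sorted : ∀ {xs} → Unique xs → AllPairs _≺_ (sort xs)
  sort-sorted {[]}     []          = []
  sort-sorted {x ∷ xs} (x∉xs ∷ xs!) =
    insert-sorted x (sort xs) (All-resp-↭ (↭-sym (sort-↭ xs)) x∉xs) (sort-sorted xs!)

module _ {A : Set} {R : Rel A ℓ} {Q : Pred A ℓ′} (Q? : Decidable₁ Q)
         (Q-down : ∀ {x y} → R x y → Q y → Q x) where

  lookup⇔<length-filter : ∀ {ws} → AllPairs R ws → ∀ k (k<∣ws∣ : k < length ws) →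
                          Q (List.lookup ws (fromℕ< k<∣ws∣)) ⇔ k < length (filter Q? ws)
  lookup⇔<length-filter {w ∷ ws} (w≺ws ∷ _) zero _ with Q? w
  ... | yes Qw  = mk⇔ (λ _ → s≤s z≤n) (λ _ → Qw)
  ... | no  ¬Qw = mk⇔ (⊥-elim ∘ ¬Qw) (λ 0<∣ws∣ → contradiction 0<∣ws∣ none)
    where
      none : ¬ 0 < length (filter Q? ws)
      none rewrite filter-none Q? (All.map (λ wRy Qy → ¬Qw (Q-down wRy Qy)) w≺ws) = λ ()
  lookup⇔<length-filter {w ∷ ws} (w≺ws ∷ ws↑) (suc k) (s≤s k<∣ws∣)
    with lookup⇔<length-filter ws↑ k k<∣ws∣ | Q? w
  ... | ih | yes _   = mk⇔ (s≤s ∘ Equivalence.to ih) (Equivalence.from ih ∘ ≤-pred)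
  ... | ih | no  ¬Qw = mk⇔ (λ Qwₖ → contradiction (Q-down wRwₖ Qwₖ) ¬Qw)
                           (λ lt → contradiction (Q-down wRwₖ (Equivalence.from ih (<-trans (n<1+n k) lt))) ¬Qw)
    where
      wRwₖ : R w (List.lookup ws (fromℕ< k<∣ws∣))
      wRwₖ = All.lookup w≺ws (∈-lookup (fromℕ< k<∣ws∣))

AllFrom : {A : Set} → (ℕ → A → Set) → ℕ → List A → Set
AllFrom P y []       = ⊤
AllFrom P y (w ∷ ws) = P y w × AllFrom P (suc y) ws

AllFrom⇔lookup : ∀ {A : Set} {P : ℕ → A → Set} y ws →
                 AllFrom P y ws ⇔ (∀ k (k<∣ws∣ : k < length ws) → P (y + k) (List.lookup ws (fromℕ< k<∣ws∣)))
AllFrom⇔lookup y []       = mk⇔ (λ _ _ ()) (λ _ → tt)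
AllFrom⇔lookup {P = P} y (w ∷ ws) = mk⇔
  (λ (Pw , Pws) → λ where
    zero    _          → subst (λ z → P z w) (sym (+-identityʳ y)) Pw
    (suc k) (s≤s k<∣ws∣) → subst (λ z → P z (List.lookup ws (fromℕ< k<∣ws∣))) (sym (+-suc y k))
                                 (Equivalence.to ih Pws k k<∣ws∣))
  (λ Pₖ → subst (λ z → P z w) (+-identityʳ y) (Pₖ 0 (s≤s z≤n)) ,
          Equivalence.from ih (λ k k<∣ws∣ → subst (λ z → P z (List.lookup ws (fromℕ< k<∣ws∣))) (+-suc y k)
                                                  (Pₖ (suc k) (s≤s k<∣ws∣))))
  where
    ih : AllFrom P (suc y) ws ⇔ (∀ k (k<∣ws∣ : k < length ws) → P (suc y + k) (List.lookup ws (fromℕ< k<∣ws∣)))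
    ih = AllFrom⇔lookup (suc y) ws

AllFrom⇔∀ : ∀ {A : Set} {P : ℕ → A → Set} {R : ℕ → Set} ws →
            (∀ k (k<∣ws∣ : k < length ws) → P k (List.lookup ws (fromℕ< k<∣ws∣)) ⇔ R k) →
            AllFrom P 0 ws ⇔ (∀ k → k < length ws → R k)
AllFrom⇔∀ ws P⇔R = mk⇔
  (λ all k k<∣ws∣ → Equivalence.to (P⇔R k k<∣ws∣) (Equivalence.to (AllFrom⇔lookup 0 ws) all k k<∣ws∣))
  (λ R-all → Equivalence.from (AllFrom⇔lookup 0 ws)
                (λ k k<∣ws∣ → Equivalence.from (P⇔R k k<∣ws∣) (R-all k k<∣ws∣)))

module _ {A : Set} {Q : Pred A ℓ} (Q? : Decidable₁ Q) where

  ∣tabulate∣≡length-filter : ∀ {m} (g : Fin m → A) →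
                             ∣ tabulate (does ∘ Q? ∘ g) ∣ ≡ length (filter Q? (List.tabulate g))
  ∣tabulate∣≡length-filter {zero}  g = refl
  ∣tabulate∣≡length-filter {suc m} g with Q? (g Fin.zero)
  ... | yes _ = cong suc (∣tabulate∣≡length-filter (g ∘ Fin.suc))
  ... | no  _ = ∣tabulate∣≡length-filter (g ∘ Fin.suc)

subsetOf : ∀ {n} {P : Pred (Fin n) ℓ} → Decidable₁ P → Subset n
subsetOf P? = tabulate (does ∘ P?)

subsetOf-cong : ∀ {n} {P : Pred (Fin n) ℓ} {Q : Pred (Fin n) ℓ′} (P? : Decidable₁ P) (Q? : Decidable₁ Q) →
                (∀ i → P i ⇔ Q i) → subsetOf P? ≡ subsetOf Q?
subsetOf-cong P? Q? P⇔Q = tabulate-cong (λ i → does-⇔ (P⇔Q i) (P? i) (Q? i))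

module _ {n} {P : Pred (Fin n) ℓ} (P? : Decidable₁ P) where

  ∈-subsetOf : ∀ {i} → i ∈ subsetOf P? ⇔ P i
  ∈-subsetOf {i} = mk⇔ to (λ Pi → lookup⇒[]= i (subsetOf P?) (trans (lookup∘tabulate _ i) (dec-true (P? i) Pi)))
    where
      to : i ∈ subsetOf P? → P i
      to i∈ with P? i | trans (sym (lookup∘tabulate (does ∘ P?) i)) ([]=⇒lookup i∈)
      ... | yes Pi | _ = Pi

  ∁-subsetOf : ∁ (subsetOf P?) ≡ subsetOf (¬? ∘ P?)
  ∁-subsetOf = sym (tabulate-∘ not (does ∘ P?))

  ∣subsetOf∣≡n∸∣complement∣ : ∀ {Q : Pred (Fin n) ℓ′} (Q? : Decidable₁ Q) → (∀ i → (¬ P i) ⇔ Q i) →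
                              ∣ subsetOf P? ∣ ≡ n ∸ ∣ subsetOf Q? ∣
  ∣subsetOf∣≡n∸∣complement∣ Q? ¬P⇔Q = begin
    ∣ subsetOf P? ∣               ≡⟨ m∸[m∸n]≡n (∣p∣≤n (subsetOf P?)) ⟨
    n ∸ (n ∸ ∣ subsetOf P? ∣)     ≡⟨ cong (n ∸_) (∣∁p∣≡n∸∣p∣ (subsetOf P?)) ⟨
    n ∸ ∣ ∁ (subsetOf P?) ∣       ≡⟨ cong (λ S → n ∸ ∣ S ∣) (trans ∁-subsetOf (subsetOf-cong (¬? ∘ P?) Q? ¬P⇔Q)) ⟩
    n ∸ ∣ subsetOf Q? ∣           ∎
    where open ≡-Reasoning

  length-filter≡∣subsetOf∣ : ∀ {ws} → ws ↭ allFin n → length (filter P? ws) ≡ ∣ subsetOf P? ∣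
  length-filter≡∣subsetOf∣ ws↭ = trans (↭-length (filter-↭ P? ws↭)) (sym (∣tabulate∣≡length-filter P? (λ i → i)))

0<∣p∣⇒nonempty : ∀ {n} (S : Subset n) → 0 < ∣ S ∣ → Nonempty S
0<∣p∣⇒nonempty {n} S 0<∣S∣ with nonempty? S
... | yes S≢∅ = S≢∅
... | no  S≡∅ = contradiction (subst (λ T → 0 < ∣ T ∣) (Empty-unique S≡∅) 0<∣S∣)
                            (λ 0<∣⊥∣ → <⇒≢ 0<∣⊥∣ (sym (∣⊥∣≡0 n)))

lookup⇔<∣subsetOf∣ : ∀ {n} {_≺_ : Rel (Fin n) ℓ} {Q : Pred (Fin n) ℓ′} (Q? : Decidable₁ Q) →
                    (∀ {x y} → x ≺ y → Q y → Q x) → ∀ {ws} → ws ↭ allFin n → AllPairs _≺_ ws →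
                    ∀ k (k<∣ws∣ : k < length ws) → Q (List.lookup ws (fromℕ< k<∣ws∣)) ⇔ k < ∣ subsetOf Q? ∣
lookup⇔<∣subsetOf∣ {Q = Q} Q? Q-down {ws} ws↭ ws↑ k k<∣ws∣ =
  subst (λ m → Q (List.lookup ws (fromℕ< k<∣ws∣)) ⇔ k < m) (length-filter≡∣subsetOf∣ Q? ws↭)
        (lookup⇔<length-filter Q? Q-down ws↑ k k<∣ws∣)

-- The floor function t ↦ ⌊t a / b⌋

module FloorDivision (a n : ℕ) where

  b : ℕ
  b = suc n

  -- `fl (t * a) b` of Defs: firing S moves c ∣ S ∣ chips onto each vertex outside S
  -- at a cost of 1 + c (b ∸ ∣ S ∣) chips for each vertex of S.
  c : ℕ → ℕ
  c t = t * a / b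

  ≤c⇔ : ∀ {v t} → v ≤ c t ⇔ b * v ≤ a * t
  ≤c⇔ {v} {t} = mk⇔
    (λ v≤ct → subst₂ _≤_ (*-comm v b) (*-comm t a) (≤-trans (*-monoˡ-≤ b v≤ct) (m/n*n≤m (t * a) b)))
    (λ bv≤at → subst (_≤ c t) (m*n/n≡m v b) (/-monoˡ-≤ b (subst₂ _≤_ (*-comm b v) (*-comm a t) bv≤at)))

  c-mono : ∀ {t u} → t ≤ u → c t ≤ c u
  c-mono t≤u = /-monoˡ-≤ b (*-monoˡ-≤ a t≤u)

  c-superadditive : ∀ t u → c t + c u ≤ c (t + u)
  c-superadditive t u = Equivalence.from ≤c⇔ (begin
    b * (c t + c u)   ≡⟨ *-distribˡ-+ b (c t) (c u) ⟩
    b * c t + b * c u ≤⟨ +-mono-≤ (Equivalence.to ≤c⇔ ≤-refl) (Equivalence.to ≤c⇔ ≤-refl) ⟩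
    a * t + a * u     ≡⟨ *-distribˡ-+ a t u ⟨
    a * (t + u)       ∎)
    where open ≤-Reasoning

  ≤+c⇔ : ∀ m x u → m ≤ x + c u ⇔ b * m ≤ b * x + a * u
  ≤+c⇔ m x u = mk⇔ to from
    where
      to : m ≤ x + c u → b * m ≤ b * x + a * u
      to m≤ = begin
        b * m           ≤⟨ *-monoʳ-≤ b m≤ ⟩
        b * (x + c u)   ≡⟨ *-distribˡ-+ b x (c u) ⟩
        b * x + b * c u ≤⟨ +-monoʳ-≤ (b * x) (Equivalence.to ≤c⇔ ≤-refl) ⟩
        b * x + a * u   ∎
        where open ≤-Reasoning
      from : b * m ≤ b * x + a * u → m ≤ x + c u
      from bm≤ with m ≤? x + c u
      ... | yes m≤ = m≤
      ... | no  m≰ = contradiction (Equivalence.from ≤c⇔ (+-cancelˡ-≤ (b * x) _ _ (begin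
        b * x + b * suc (c u) ≡⟨ *-distribˡ-+ b x (suc (c u)) ⟨
        b * (x + suc (c u))   ≡⟨ cong (b *_) (+-suc x (c u)) ⟩
        b * suc (x + c u)     ≤⟨ *-monoʳ-≤ b (≰⇒> m≰) ⟩
        b * m                 ≤⟨ bm≤ ⟩
        b * x + a * u         ∎))) (n≮n (c u))
        where open ≤-Reasoning

  M : ℕ
  M = c n

  e : ℕ
  e = suc (a / b)

  module _ (1≤n : 1 ≤ n) (coprime : Coprime a b) where

    -- The remainders of n·a and a modulo b sum to a multiple of b in (0, 2b), hence to b.
    M+e≡a : M + e ≡ a
    M+e≡a = trans (+-suc M q) (≤-antisym (*-cancelʳ-< b (M + q) a below) (≤-pred (*-cancelʳ-< b a _ above)))
      where
        q r ρ : ℕ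
        q = a / b
        r = a % b
        ρ = n * a % b

        0<r : 0 < r
        0<r = n≢0⇒n>0 λ r≡0 →
          <⇒≢ 1≤n (sym (suc-injective (coprime (m%n≡0⇒n∣m a b r≡0 , ∣-refl))))

        remainders : (M + q) * b + (ρ + r) ≡ a * b
        remainders = begin
          (M + q) * b + (ρ + r)     ≡⟨ regroup M q b ρ r ⟩
          (ρ + M * b) + (r + q * b) ≡⟨ cong₂ _+_ (m≡m%n+[m/n]*n (n * a) b) (m≡m%n+[m/n]*n a b) ⟨
          n * a + a                 ≡⟨ +-comm (n * a) a ⟩
          b * a                     ≡⟨ *-comm b a ⟩
          a * b                     ∎
          where
            open ≡-Reasoning
            regroup : ∀ M q b ρ r → (M + q) * b + (ρ + r) ≡ (ρ + M * b) + (r + q * b)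
            regroup = solve-∀

        below : (M + q) * b < a * b
        below = subst ((M + q) * b <_) remainders
                  (subst (_< (M + q) * b + (ρ + r)) (+-identityʳ _) (+-monoʳ-< _ (m≤n⇒m≤o+n ρ 0<r)))

        above : a * b < suc (suc (M + q)) * b
        above = subst₂ _<_ remainders (twice M q b) (+-monoʳ-< _ (+-mono-< (m%n<n (n * a) b) (m%n<n a b)))
          where
            twice : ∀ M q b → (M + q) * b + (b + b) ≡ suc (suc (M + q)) * b
            twice = solve-∀

    -- a (k + 1) ≤ b (x + e) is the diagonal constraint of the inverted triangle at the point (x , k + 1).
    top-of-north-step⇔ : ∀ x k → k ≤ n → M ≤ x + c (n ∸ k) ⇔ a * suc k ≤ b * (x + e)
    top-of-north-step⇔ x k k≤n = mk⇔ to from ⇔-∘ ≤+c⇔ M x u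
      where
        s u Z : ℕ
        s = suc k
        u = n ∸ k
        Z = b * e + a * s

        u+s≡b : u + s ≡ b
        u+s≡b = trans (+-suc u k) (cong suc (m∸n+n≡m k≤n))

        left : b * M + Z ≡ a * b + a * s
        left = begin
          b * M + (b * e + a * s) ≡⟨ regroup b M e a s ⟩
          b * (M + e) + a * s     ≡⟨ cong (λ m → b * m + a * s) M+e≡a ⟩
          b * a + a * s           ≡⟨ cong (_+ a * s) (*-comm b a) ⟩
          a * b + a * s           ∎
          where
            open ≡-Reasoning
            regroup : ∀ b M e a s → b * M + (b * e + a * s) ≡ b * (M + e) + a * s
            regroup = solve-∀

        right : b * x + a * u + Z ≡ a * b + b * (x + e)
        right = begin
          b * x + a * u + (b * e + a * s) ≡⟨ regroup b x a u e s ⟩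
          a * (u + s) + b * (x + e)       ≡⟨ cong (λ t → a * t + b * (x + e)) u+s≡b ⟩
          a * b + b * (x + e)             ∎
          where
            open ≡-Reasoning
            regroup : ∀ b x a u e s → b * x + a * u + (b * e + a * s) ≡ a * (u + s) + b * (x + e)
            regroup = solve-∀

        to : b * M ≤ b * x + a * u → a * s ≤ b * (x + e)
        to h = +-cancelˡ-≤ (a * b) _ _ (subst₂ _≤_ left right (+-monoˡ-≤ Z h))

        from : a * s ≤ b * (x + e) → b * M ≤ b * x + a * u
        from h = +-cancelʳ-≤ Z _ _ (subst₂ _≤_ (sym left) (sym right) (+-monoʳ-≤ (a * b) h))

-- Firing, borrowing and the counting conditions

module ChipFiring (a n : ℕ) where

  open FloorDivision a n

  private
    0≤z-k⇔ : ∀ {z} k → + 0 ℤ.≤ z → (+ 0 ℤ.≤ z ℤ.- + k ⇔ k ≤ ℤ.∣ z ∣)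
    0≤z-k⇔ k (ℤ.+≤+ _) = 0≤+m-+k⇔k≤m

    0≤z+k : ∀ {z} k → + 0 ℤ.≤ z → + 0 ℤ.≤ z ℤ.+ + k
    0≤z+k k (ℤ.+≤+ _) = ℤ.+≤+ z≤n

    ∣z+k∣ : ∀ {z} k → + 0 ℤ.≤ z → ℤ.∣ z ℤ.+ + k ∣ ≡ ℤ.∣ z ∣ + k
    ∣z+k∣ k (ℤ.+≤+ _) = refl

    ∣z-k∣≤∣z∣ : ∀ {z} k → + 0 ℤ.≤ z → k ≤ ℤ.∣ z ∣ → ℤ.∣ z ℤ.- + k ∣ ≤ ℤ.∣ z ∣
    ∣z-k∣≤∣z∣ {z} k (ℤ.+≤+ _) k≤z =
      subst (_≤ ℤ.∣ z ∣) (cong ℤ.∣_∣ (sym (+m-+k≡+[m∸k] k≤z))) (m∸n≤m _ k)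

    ∉⇒lookup≡false : ∀ {i} {S : Subset b} → i ∉ S → lookup S i ≡ false
    ∉⇒lookup≡false {i} {S} i∉S with lookup S i in eq
    ... | true  = contradiction (lookup⇒[]= i S eq) i∉S
    ... | false = refl

  module _ (S : Subset b) (D : Config b) {i : Fin b} where

    φ-∈ : i ∈ S → φ a b S D i ≡ D i ℤ.- + suc (c (b ∸ ∣ S ∣))
    φ-∈ i∈S rewrite []=⇒lookup i∈S = refl

    φ-∉ : i ∉ S → φ a b S D i ≡ D i ℤ.+ + c ∣ S ∣
    φ-∉ i∉S rewrite ∉⇒lookup≡false i∉S = refl

    β-∈ : i ∈ S → β a b S D i ≡ D i ℤ.+ + suc (c (b ∸ ∣ S ∣))
    β-∈ i∈S rewrite []=⇒lookup i∈S = refl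

    β-∉ : i ∉ S → β a b S D i ≡ D i ℤ.- + c ∣ S ∣
    β-∉ i∉S rewrite ∉⇒lookup≡false i∉S = refl

  φ∘β : ∀ S D i → φ a b S (β a b S D) i ≡ D i
  φ∘β S D i with i ∈? S
  ... | yes i∈S =
    trans (φ-∈ S (β a b S D) i∈S) (trans (cong (ℤ._- + suc (c (b ∸ ∣ S ∣))) (β-∈ S D i∈S)) (x+k-k≡x (D i) _))
    where
      x+k-k≡x : ∀ x k → x ℤ.+ k ℤ.- k ≡ x
      x+k-k≡x = ℤ-Solver.solve-∀
  ... | no  i∉S = trans (φ-∉ S (β a b S D) i∉S) (trans (cong (ℤ._+ + c ∣ S ∣) (β-∉ S D i∉S)) (x-k+k≡x (D i) _))
    where
      x-k+k≡x : ∀ x k → x ℤ.- k ℤ.+ k ≡ x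
      x-k+k≡x = ℤ-Solver.solve-∀

  φ-legal⇔ : ∀ S {D} → NonNeg D → NonNeg (φ a b S D) ⇔ (∀ i → i ∈ S → c (b ∸ ∣ S ∣) < ℤ.∣ D i ∣)
  φ-legal⇔ S {D} D≥0 = mk⇔
    (λ φ≥0 i i∈S → Equivalence.to (0≤z-k⇔ _ (D≥0 i)) (subst (+ 0 ℤ.≤_) (φ-∈ S D i∈S) (φ≥0 i)))
    from
    where
      from : (∀ i → i ∈ S → c (b ∸ ∣ S ∣) < ℤ.∣ D i ∣) → NonNeg (φ a b S D)
      from legal i with i ∈? S
      ... | yes i∈S = subst (+ 0 ℤ.≤_) (sym (φ-∈ S D i∈S)) (Equivalence.from (0≤z-k⇔ _ (D≥0 i)) (legal i i∈S))
      ... | no  i∉S = subst (+ 0 ℤ.≤_) (sym (φ-∉ S D i∉S)) (0≤z+k _ (D≥0 i))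

  stable₀⇔bounded : ∀ {D} → Stable a b 0 D ⇔ (NonNeg D × (∀ i → ℤ.∣ D i ∣ ≤ M))
  stable₀⇔bounded {D} = mk⇔
    (λ (D≥0 , stable) → D≥0 , λ i → ≮⇒≥ λ M<Dᵢ →
      stable ⁅ i ⁆ (≤-reflexive (sym (∣⁅x⁆∣≡1 i))) (≤-reflexive (∣⁅x⁆∣≡1 i))
        (Equivalence.from (φ-legal⇔ ⁅ i ⁆ D≥0) λ j j∈⁅i⁆ →
          subst₂ (λ s j → c (b ∸ s) < ℤ.∣ D j ∣) (sym (∣⁅x⁆∣≡1 i)) (sym (x∈⁅y⁆⇒x≡y i j∈⁅i⁆)) M<Dᵢ))
    (λ (D≥0 , D≤M) → D≥0 , λ S 0<∣S∣ ∣S∣≤1 φ≥0 →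
      let (i , i∈S) = 0<∣p∣⇒nonempty S 0<∣S∣ in
      <⇒≱ (Equivalence.to (φ-legal⇔ S D≥0) φ≥0 i i∈S) (≤-trans (D≤M i) (c-mono (∸-monoʳ-≤ b ∣S∣≤1))))

  superstable⇒stable₀ : ∀ {D} → Superstable a b D → Stable a b 0 D
  superstable⇒stable₀ (D≥0 , stable) = D≥0 , λ S 0<∣S∣ ∣S∣≤1 → stable S 0<∣S∣ (≤-trans ∣S∣≤1 (s≤s z≤n))

  Borrowable : Subset b → Config b → Set
  Borrowable T D = (∀ i → i ∈ T → ℤ.∣ D i ∣ + suc (c (b ∸ ∣ T ∣)) ≤ M) × (∀ j → j ∉ T → c ∣ T ∣ ≤ ℤ.∣ D j ∣)

  borrowing-stable₀⇔ : ∀ T {D} → Stable a b 0 D → Stable a b 0 (β a b T D) ⇔ Borrowable T D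
  borrowing-stable₀⇔ T {D} D-stable = mk⇔ to from ⇔-∘ stable₀⇔bounded
    where
      D≥0 : NonNeg D
      D≥0 = proj₁ (Equivalence.to stable₀⇔bounded D-stable)
      D≤M : ∀ i → ℤ.∣ D i ∣ ≤ M
      D≤M = proj₂ (Equivalence.to stable₀⇔bounded D-stable)
      to : NonNeg (β a b T D) × (∀ i → ℤ.∣ β a b T D i ∣ ≤ M) → Borrowable T D
      to (β≥0 , β≤M) =
        (λ i i∈T → subst (_≤ M) (trans (cong ℤ.∣_∣ (β-∈ T D i∈T)) (∣z+k∣ _ (D≥0 i))) (β≤M i)) ,
        (λ j j∉T → Equivalence.to (0≤z-k⇔ _ (D≥0 j)) (subst (+ 0 ℤ.≤_) (β-∉ T D j∉T) (β≥0 j)))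
      from : Borrowable T D → NonNeg (β a b T D) × (∀ i → ℤ.∣ β a b T D i ∣ ≤ M)
      from (inside , outside) = β≥0 , β≤M
        where
          β≥0 : NonNeg (β a b T D)
          β≥0 i with i ∈? T
          ... | yes i∈T = subst (+ 0 ℤ.≤_) (sym (β-∈ T D i∈T)) (0≤z+k _ (D≥0 i))
          ... | no  i∉T =
            subst (+ 0 ℤ.≤_) (sym (β-∉ T D i∉T)) (Equivalence.from (0≤z-k⇔ _ (D≥0 i)) (outside i i∉T))
          β≤M : ∀ i → ℤ.∣ β a b T D i ∣ ≤ M
          β≤M i with i ∈? T
          ... | yes i∈T = subst (_≤ M) (sym (trans (cong ℤ.∣_∣ (β-∈ T D i∈T)) (∣z+k∣ _ (D≥0 i)))) (inside i i∈T)
          ... | no  i∉T = subst (_≤ M) (cong ℤ.∣_∣ (sym (β-∉ T D i∉T)))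
                            (≤-trans (∣z-k∣≤∣z∣ _ (D≥0 i) (outside i i∉T)) (D≤M i))

  atMost : Config b → ℕ → Subset b
  atMost D t = subsetOf (λ i → ℤ.∣ D i ∣ ≤? t)

  canBorrow : Config b → ℕ → Subset b
  canBorrow D s = subsetOf (λ i → ℤ.∣ D i ∣ + suc (c (b ∸ s)) ≤? M)

  ∈-atMost : ∀ D t {i} → i ∈ atMost D t ⇔ ℤ.∣ D i ∣ ≤ t
  ∈-atMost D t = ∈-subsetOf (λ i → ℤ.∣ D i ∣ ≤? t)

  ∈-canBorrow : ∀ D s {i} → i ∈ canBorrow D s ⇔ ℤ.∣ D i ∣ + suc (c (b ∸ s)) ≤ M
  ∈-canBorrow D s = ∈-subsetOf (λ i → ℤ.∣ D i ∣ + suc (c (b ∸ s)) ≤? M)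

  SuperstableCounts : Config b → Set
  SuperstableCounts D = ∀ p → p < b → p < ∣ atMost D (c p) ∣

  SkeletalCounts : Config b → Set
  SkeletalCounts D = ∀ s → 0 < s → s ≤ b → ∣ canBorrow D s ∣ < s

  superstable⇒counts : ∀ {D} → Superstable a b D → SuperstableCounts D
  superstable⇒counts {D} (D≥0 , stable) p p<b with p <? ∣ atMost D (c p) ∣
  ... | yes p<∣A∣ = p<∣A∣
  ... | no  p≮∣A∣ = contradiction legal (stable S 0<∣S∣ (∣p∣≤n S))
    where
      A S : Subset b
      A = atMost D (c p)
      S = ∁ A
      ∣A∣≤p : ∣ A ∣ ≤ p
      ∣A∣≤p = ≮⇒≥ p≮∣A∣
      ∣S∣≡b∸∣A∣ : ∣ S ∣ ≡ b ∸ ∣ A ∣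
      ∣S∣≡b∸∣A∣ = ∣∁p∣≡n∸∣p∣ A
      0<∣S∣ : 0 < ∣ S ∣
      0<∣S∣ = subst (0 <_) (sym ∣S∣≡b∸∣A∣) (m<n⇒0<n∸m (≤-<-trans ∣A∣≤p p<b))
      legal : NonNeg (φ a b S D)
      legal = Equivalence.from (φ-legal⇔ S D≥0) λ i i∈S → begin-strict
        c (b ∸ ∣ S ∣)       ≡⟨ cong (λ s → c (b ∸ s)) ∣S∣≡b∸∣A∣ ⟩
        c (b ∸ (b ∸ ∣ A ∣)) ≡⟨ cong c (m∸[m∸n]≡n (∣p∣≤n A)) ⟩
        c ∣ A ∣             ≤⟨ c-mono ∣A∣≤p ⟩
        c p                 <⟨ ≰⇒> (x∈∁p⇒x∉p i∈S ∘ Equivalence.from (∈-atMost D (c p))) ⟩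
        ℤ.∣ D i ∣           ∎
        where open ≤-Reasoning

  counts⇒superstable : ∀ {D} → NonNeg D → SuperstableCounts D → Superstable a b D
  counts⇒superstable {D} D≥0 counts = D≥0 , λ S 0<∣S∣ _ φ≥0 → <-irrefl refl (begin-strict
      ∣ S ∣               ≤⟨ p⊆q⇒∣p∣≤∣q∣ (S⊆∁A S φ≥0) ⟩
      ∣ ∁ (A S) ∣         ≡⟨ ∣∁p∣≡n∸∣p∣ (A S) ⟩
      b ∸ ∣ A S ∣         <⟨ ∸-monoʳ-< (counts (b ∸ ∣ S ∣) (∸-monoʳ-< 0<∣S∣ (∣p∣≤n S))) (∣p∣≤n (A S)) ⟩
      b ∸ (b ∸ ∣ S ∣)     ≡⟨ m∸[m∸n]≡n (∣p∣≤n S) ⟩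
      ∣ S ∣               ∎)
    where
      open ≤-Reasoning
      A : Subset b → Subset b
      A S = atMost D (c (b ∸ ∣ S ∣))
      S⊆∁A : ∀ S → NonNeg (φ a b S D) → S ⊆ ∁ (A S)
      S⊆∁A S φ≥0 i∈S = x∉p⇒x∈∁p (<⇒≱ (Equivalence.to (φ-legal⇔ S D≥0) φ≥0 _ i∈S) ∘ Equivalence.to (∈-atMost D _))

  superstable⇒skeletal : ∀ {D} → Superstable a b D → Skeletal a b n D
  superstable⇒skeletal {D} D-super@(D≥0 , _) = D-super , λ T 0<∣T∣ _ (_ , stable) →
    stable T 0<∣T∣ (∣p∣≤n T) (λ i → subst (+ 0 ℤ.≤_) (sym (φ∘β T D i)) (D≥0 i))

  skeletal₀⇒¬borrowable : ∀ {D} → Skeletal a b 0 D → ∀ T → 0 < ∣ T ∣ → ¬ Borrowable T D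
  skeletal₀⇒¬borrowable {D} (D-stable , skeletal) T 0<∣T∣ T-borrowable = skeletal T 0<∣T∣ (proj₁ β-stable) β-stable
    where
      β-stable : Stable a b 0 (β a b T D)
      β-stable = Equivalence.from (borrowing-stable₀⇔ T D-stable) T-borrowable

  borrowable⇒⊆canBorrow : ∀ D {T} → Borrowable T D → T ⊆ canBorrow D ∣ T ∣
  borrowable⇒⊆canBorrow D {T} (inside , _) i∈T = Equivalence.from (∈-canBorrow D ∣ T ∣) (inside _ i∈T)

  canBorrow-mono : ∀ D {s s′} → s ≤ s′ → canBorrow D s ⊆ canBorrow D s′
  canBorrow-mono D {s} {s′} s≤s′ i∈G = Equivalence.from (∈-canBorrow D s′)
    (≤-trans (+-monoʳ-≤ _ (s≤s (c-mono (∸-monoʳ-≤ b s≤s′)))) (Equivalence.to (∈-canBorrow D s) i∈G))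

  ∉canBorrow⇒c≤ : ∀ D {s j} → s < b → j ∉ canBorrow D (suc s) → c s ≤ ℤ.∣ D j ∣
  ∉canBorrow⇒c≤ D {s} {j} s<b j∉G = +-cancelʳ-≤ (c (n ∸ s)) _ _ (begin
    c s + c (n ∸ s)           ≤⟨ c-superadditive s (n ∸ s) ⟩
    c (s + (n ∸ s))           ≡⟨ cong c (m+[n∸m]≡n (≤-pred s<b)) ⟩
    M                         ≤⟨ Equivalence.to ≰+suc⇔≥+ (j∉G ∘ Equivalence.from (∈-canBorrow D (suc s))) ⟩
    ℤ.∣ D j ∣ + c (n ∸ s)     ∎)
    where open ≤-Reasoning

  canBorrow-borrowable : ∀ D {s} → ∣ canBorrow D s ∣ ≡ s → (∀ j → j ∉ canBorrow D s → c s ≤ ℤ.∣ D j ∣) →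
                         Borrowable (canBorrow D s) D
  canBorrow-borrowable D {s} ∣G∣≡s outside =
    (λ i i∈G → subst (λ t → ℤ.∣ D i ∣ + suc (c (b ∸ t)) ≤ M) (sym ∣G∣≡s) (Equivalence.to (∈-canBorrow D s) i∈G)) ,
    (λ j j∉G → subst (λ t → c t ≤ ℤ.∣ D j ∣) (sym ∣G∣≡s) (outside j j∉G))

  skeletal₀⇒counts : ∀ {D} → Skeletal a b 0 D → SkeletalCounts D
  skeletal₀⇒counts {D} D-skeletal s 0<s s≤b = downward-induction (λ s → ∣ G s ∣ < s) base step 0<s s≤b
    where
      G : ℕ → Subset b
      G = canBorrow D

      forbidden : ∀ {s} → 0 < s → ∣ G s ∣ ≡ s → ¬ (∀ j → j ∉ G s → c s ≤ ℤ.∣ D j ∣)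
      forbidden {s} 0<s ∣G∣≡s outside = skeletal₀⇒¬borrowable D-skeletal (G s) (subst (0 <_) (sym ∣G∣≡s) 0<s)
                                      (canBorrow-borrowable D ∣G∣≡s outside)

      base : ∣ G b ∣ < b
      base with ∣ G b ∣ <? b
      ... | yes ∣G∣<b = ∣G∣<b
      ... | no  ∣G∣≮b = contradiction (λ j j∉G → contradiction (subst (j ∈_) (sym (∣p∣≡n⇒p≡⊤ ∣G∣≡b)) ∈⊤) j∉G)
                                      (forbidden (s≤s z≤n) ∣G∣≡b)
        where
          ∣G∣≡b : ∣ G b ∣ ≡ b
          ∣G∣≡b = ≤-antisym (∣p∣≤n (G b)) (≮⇒≥ ∣G∣≮b)

      -- If ∣ G s ∣ ≥ s but ∣ G (s + 1) ∣ ≤ s, then G s = G (s + 1) has s elements and is borrowable.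
      step : ∀ {s} → 1 ≤ s → s < b → ∣ G (suc s) ∣ < suc s → ∣ G s ∣ < s
      step {s} 1≤s s<b ∣G′∣<1+s with ∣ G s ∣ <? s
      ... | yes ∣G∣<s = ∣G∣<s
      ... | no  ∣G∣≮s = contradiction (λ j j∉G → ∉canBorrow⇒c≤ D s<b (G′-avoids j j∉G)) (forbidden 1≤s ∣G∣≡s)
        where
          G⊆G′ : G s ⊆ G (suc s)
          G⊆G′ = canBorrow-mono D (n≤1+n s)
          ∣G∣≡s : ∣ G s ∣ ≡ s
          ∣G∣≡s = ≤-antisym (≤-pred (≤-<-trans (p⊆q⇒∣p∣≤∣q∣ G⊆G′) ∣G′∣<1+s)) (≮⇒≥ ∣G∣≮s)
          G′-avoids : ∀ j → j ∉ G s → j ∉ G (suc s)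
          G′-avoids j j∉G j∈G′ = <-irrefl ∣G∣≡s (<-≤-trans (p⊂q⇒∣p∣<∣q∣ (G⊆G′ , j , j∈G′ , j∉G)) (≤-pred ∣G′∣<1+s))

  counts⇒skeletal₀ : ∀ {D} → Stable a b 0 D → SkeletalCounts D → Skeletal a b 0 D
  counts⇒skeletal₀ {D} D-stable counts = D-stable , λ T 0<∣T∣ _ β-stable → <-irrefl refl (≤-<-trans
    (p⊆q⇒∣p∣≤∣q∣ (borrowable⇒⊆canBorrow D (Equivalence.to (borrowing-stable₀⇔ T D-stable) β-stable)))
    (counts ∣ T ∣ 0<∣T∣ (∣p∣≤n T)))

  ∣canBorrow∣≡b∸∣atMost∣ : ∀ D′ s D t → (∀ i → (¬ ℤ.∣ D′ i ∣ + suc (c (b ∸ s)) ≤ M) ⇔ ℤ.∣ D i ∣ ≤ t) →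
                           ∣ canBorrow D′ s ∣ ≡ b ∸ ∣ atMost D t ∣
  ∣canBorrow∣≡b∸∣atMost∣ D′ s D t =
    ∣subsetOf∣≡n∸∣complement∣ (λ i → ℤ.∣ D′ i ∣ + suc (c (b ∸ s)) ≤? M) (λ i → ℤ.∣ D i ∣ ≤? t)

-- The flip D ↦ a − e − D

flipConfig-involutive : ∀ a b D i → flipConfig a b (flipConfig a b D) i ≡ D i
flipConfig-involutive a b D i = x-[x-y]≡y (+ a ℤ.- + eOf a b) (D i)
  where
    x-[x-y]≡y : ∀ x y → x ℤ.- (x ℤ.- y) ≡ y
    x-[x-y]≡y = ℤ-Solver.solve-∀

flipConfig-injective : ∀ a b D₁ D₂ i → flipConfig a b D₁ i ≡ flipConfig a b D₂ i → D₁ i ≡ D₂ i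
flipConfig-injective a b D₁ D₂ i eq = begin
  D₁ i                                   ≡⟨ flipConfig-involutive a b D₁ i ⟨
  flipConfig a b (flipConfig a b D₁) i   ≡⟨ cong (λ z → + a ℤ.- + eOf a b ℤ.- z) eq ⟩
  flipConfig a b (flipConfig a b D₂) i   ≡⟨ flipConfig-involutive a b D₂ i ⟩
  D₂ i                                   ∎
  where open ≡-Reasoning


module FlipCorrespondence (a n : ℕ) (1≤n : 1 ≤ n) (coprime : Coprime a (suc n)) where

  open FloorDivision a n
  open ChipFiring a n

  private
    a-e≡M : + a ℤ.- + e ≡ + M
    a-e≡M = trans (+m-+k≡+[m∸k] (subst (e ≤_) (M+e≡a 1≤n coprime) (m≤n+m e M)))
                  (cong +_ (subst (λ a → a ∸ e ≡ M) (M+e≡a 1≤n coprime) (m+n∸n≡m M e)))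

  flip-value : ∀ {D} → Stable a b 0 D → ∀ i → flipConfig a b D i ≡ + (M ∸ ℤ.∣ D i ∣)
  flip-value {D} D-stable i = begin
    + a ℤ.- + e ℤ.- D i     ≡⟨ cong₂ ℤ._-_ a-e≡M (sym (ZP.0≤i⇒+∣i∣≡i (proj₁ D-bounded i))) ⟩
    + M ℤ.- + ℤ.∣ D i ∣     ≡⟨ +m-+k≡+[m∸k] (proj₂ D-bounded i) ⟩
    + (M ∸ ℤ.∣ D i ∣)       ∎
    where
      open ≡-Reasoning
      D-bounded : NonNeg D × (∀ i → ℤ.∣ D i ∣ ≤ M)
      D-bounded = Equivalence.to stable₀⇔bounded D-stable

  flip-stable₀ : ∀ {D} → Stable a b 0 D → Stable a b 0 (flipConfig a b D)
  flip-stable₀ {D} D-stable = Equivalence.from stable₀⇔bounded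
    ( (λ i → subst (+ 0 ℤ.≤_) (sym (flip-value D-stable i)) (ℤ.+≤+ z≤n))
    , (λ i → subst (_≤ M) (cong ℤ.∣_∣ (sym (flip-value D-stable i))) (m∸n≤m M ℤ.∣ D i ∣)))

  superstable⇒flip-skeletal₀ : ∀ {D} → Superstable a b D → Skeletal a b 0 (flipConfig a b D)
  superstable⇒flip-skeletal₀ {D} D-super =
    counts⇒skeletal₀ (flip-stable₀ D-stable) flip-counts
    where
      D-stable : Stable a b 0 D
      D-stable = superstable⇒stable₀ D-super
      D′ : Config b
      D′ = flipConfig a b D

      complementary : ∀ s i → (¬ ℤ.∣ D′ i ∣ + suc (c (b ∸ s)) ≤ M) ⇔ ℤ.∣ D i ∣ ≤ c (b ∸ s)
      complementary s i =
        subst (λ x → (¬ ℤ.∣ D′ i ∣ + suc (c (b ∸ s)) ≤ M) ⇔ x ≤ c (b ∸ s)) M∸∣D′ᵢ∣≡∣Dᵢ∣ ≰+suc⇔∸≤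
        where
          M∸∣D′ᵢ∣≡∣Dᵢ∣ : M ∸ ℤ.∣ D′ i ∣ ≡ ℤ.∣ D i ∣
          M∸∣D′ᵢ∣≡∣Dᵢ∣ = trans (cong (λ z → M ∸ ℤ.∣ z ∣) (flip-value D-stable i))
                               (m∸[m∸n]≡n (proj₂ (Equivalence.to stable₀⇔bounded D-stable) i))

      flip-counts : SkeletalCounts D′
      flip-counts s 0<s s≤b = begin-strict
        ∣ canBorrow D′ s ∣            ≡⟨ ∣canBorrow∣≡b∸∣atMost∣ D′ s D _ (complementary s) ⟩
        b ∸ ∣ atMost D (c (b ∸ s)) ∣  <⟨ ∸-monoʳ-< (superstable⇒counts D-super (b ∸ s) (∸-monoʳ-< 0<s s≤b))
                                                   (∣p∣≤n (atMost D (c (b ∸ s)))) ⟩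
        b ∸ (b ∸ s)                   ≡⟨ m∸[m∸n]≡n s≤b ⟩
        s                             ∎
        where open ≤-Reasoning

  skeletal₀⇒flip-superstable : ∀ {D} → Skeletal a b 0 D → Superstable a b (flipConfig a b D)
  skeletal₀⇒flip-superstable {D} D-skeletal@(D-stable , _) =
    counts⇒superstable (proj₁ (flip-stable₀ D-stable)) flip-counts
    where
      D′ : Config b
      D′ = flipConfig a b D

      complementary : ∀ p → p ≤ b → ∀ i → (¬ ℤ.∣ D i ∣ + suc (c (b ∸ (b ∸ p))) ≤ M) ⇔ ℤ.∣ D′ i ∣ ≤ c p
      complementary p p≤b i rewrite m∸[m∸n]≡n p≤b | flip-value D-stable i = ≰+suc⇔∸≤

      flip-counts : SuperstableCounts D′
      flip-counts p p<b = ∸-cancelʳ-< (subst (_< b ∸ p)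
        (∣canBorrow∣≡b∸∣atMost∣ D (b ∸ p) D′ (c p) (complementary p (<⇒≤ p<b)))
        (skeletal₀⇒counts D-skeletal (b ∸ p) (m<n⇒0<n∸m p<b) (m∸n≤m b p)))

-- The poorer-than order and lattice paths

module Poorer {b} (D : Config b) where

  private
    module Lex = StrictTotalOrder (×-strictTotalOrder ZP.<-strictTotalOrder (FP.<-strictTotalOrder b))

  _≺_ : Rel (Fin b) _
  i ≺ j = (D i , i) Lex.< (D j , j)

  -- `does (i ≺? j)` unfolds to `poorer D i j`, so `sortedVertices D` is insertion sort along _≺_.
  _≺?_ : Decidable _≺_
  i ≺? j = ×-decidable ZP._≟_ ZP._<?_ FP._<?_ (D i , i) (D j , j)

  ≺-connex : ∀ {i j} → i ≢ j → ¬ i ≺ j → j ≺ i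
  ≺-connex {i} {j} i≢j i⊀j with Lex.compare (D i , i) (D j , j)
  ... | tri< i≺j _ _ = contradiction i≺j i⊀j
  ... | tri≈ _ i≈j _ = contradiction (proj₂ i≈j) i≢j
  ... | tri> _ _ j≺i = j≺i

  open InsertionSort _≺?_ Lex.trans ≺-connex using (sort-↭; sort-sorted)

  sortedVertices-↭ : sortedVertices D ↭ allFin b
  sortedVertices-↭ = sort-↭ (allFin b)

  sortedVertices-sorted : AllPairs _≺_ (sortedVertices D)
  sortedVertices-sorted = sort-sorted (allFin⁺ b)

  module _ (D≥0 : NonNeg D) where

    ≺⇒∣≤∣ : ∀ {i j} → i ≺ j → ℤ.∣ D i ∣ ≤ ℤ.∣ D j ∣
    ≺⇒∣≤∣ {i} (inj₁ Dᵢ<Dⱼ)        = ∣∣-mono-≤ (D≥0 i) (ZP.<⇒≤ Dᵢ<Dⱼ)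
      where
        ∣∣-mono-≤ : ∀ {x y} → + 0 ℤ.≤ x → x ℤ.≤ y → ℤ.∣ x ∣ ≤ ℤ.∣ y ∣
        ∣∣-mono-≤ (ℤ.+≤+ _) (ℤ.+≤+ m≤n) = m≤n
    ≺⇒∣≤∣ (inj₂ (Dᵢ≡Dⱼ , _)) = ≤-reflexive (cong ℤ.∣_∣ Dᵢ≡Dⱼ)

    ≺-tiebreak : ∀ {i j} → i ≺ j → ℤ.∣ D i ∣ ≡ ℤ.∣ D j ∣ → i Fin.< j
    ≺-tiebreak         (inj₂ (_ , i<j)) _         = i<j
    ≺-tiebreak {i} {j} (inj₁ Dᵢ<Dⱼ)     ∣Dᵢ∣≡∣Dⱼ∣ = contradiction Dᵢ<Dⱼ (ZP.<-irrefl Dᵢ≡Dⱼ)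
      where
        Dᵢ≡Dⱼ : D i ≡ D j
        Dᵢ≡Dⱼ = trans (sym (ZP.0≤i⇒+∣i∣≡i (D≥0 i))) (trans (cong +_ ∣Dᵢ∣≡∣Dⱼ∣) (ZP.0≤i⇒+∣i∣≡i (D≥0 j)))

module _ {b : ℕ} where

  labels-E^k++ : ∀ k (P : List (Step b)) → labels (replicate k E ++ P) ≡ labels P
  labels-E^k++ zero    P = refl
  labels-E^k++ (suc k) P = labels-E^k++ k P

  countE-E^k++ : ∀ k (P : List (Step b)) → countE (replicate k E ++ P) ≡ k + countE P
  countE-E^k++ zero    P = refl
  countE-E^k++ (suc k) P = cong suc (countE-E^k++ k P)

  IncRuns-E^k++ : ∀ k {P : List (Step b)} → IncRuns P → IncRuns (replicate k E ++ P)
  IncRuns-E^k++ zero    inc = inc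
  IncRuns-E^k++ (suc k) inc = IncRuns-E^k++ k inc

  northStarts-E^k++ : ∀ k x y (P : List (Step b)) →
                      northStarts (x , y) (replicate k E ++ P) ≡ northStarts (x ℤ.+ + k , y) P
  northStarts-E^k++ zero    x y P = cong (λ x → northStarts (x , y) P) (sym (ZP.+-identityʳ x))
  northStarts-E^k++ (suc k) x y P =
    trans (northStarts-E^k++ k (x ℤ.+ + 1) y P) (cong (λ x → northStarts (x , y) P) (ZP.+-assoc x (+ 1) (+ k)))

  All-vertices-E^k++ : ∀ {Q : Pred Point ℓ} k x y (P : List (Step b)) →
    All Q (vertices (x , y) (replicate k E ++ P)) ⇔
    ((∀ j → j < k → Q (x ℤ.+ + j , y)) × All Q (vertices (x ℤ.+ + k , y) P))
  All-vertices-E^k++ {Q = Q} zero x y P = mk⇔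
    (λ all → (λ _ ()) , subst (λ x → All Q (vertices (x , y) P)) (sym (ZP.+-identityʳ x)) all)
    (λ (_ , all) → subst (λ x → All Q (vertices (x , y) P)) (ZP.+-identityʳ x) all)
  All-vertices-E^k++ {Q = Q} (suc k) x y P = mk⇔ to from
    where
      ih : All Q (vertices (x ℤ.+ + 1 , y) (replicate k E ++ P)) ⇔
           ((∀ j → j < k → Q (x ℤ.+ + 1 ℤ.+ + j , y)) × All Q (vertices (x ℤ.+ + 1 ℤ.+ + k , y) P))
      ih = All-vertices-E^k++ k (x ℤ.+ + 1) y P
      x+1+j≡ : ∀ j → x ℤ.+ + 1 ℤ.+ + j ≡ x ℤ.+ + suc j
      x+1+j≡ j = ZP.+-assoc x (+ 1) (+ j)

      to : All Q (vertices (x , y) (replicate (suc k) E ++ P)) →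
           (∀ j → j < suc k → Q (x ℤ.+ + j , y)) × All Q (vertices (x ℤ.+ + suc k , y) P)
      to (Qxy ∷ all) with Equivalence.to ih all
      ... | row , rest = row′ , subst (λ x → All Q (vertices (x , y) P)) (x+1+j≡ k) rest
        where
          row′ : ∀ j → j < suc k → Q (x ℤ.+ + j , y)
          row′ zero    _         = subst (λ x → Q (x , y)) (sym (ZP.+-identityʳ x)) Qxy
          row′ (suc j) (s≤s j<k) = subst (λ x → Q (x , y)) (x+1+j≡ j) (row j j<k)

      from : (∀ j → j < suc k → Q (x ℤ.+ + j , y)) × All Q (vertices (x ℤ.+ + suc k , y) P) →
             All Q (vertices (x , y) (replicate (suc k) E ++ P))
      from (row , rest) =
        subst (λ x → Q (x , y)) (ZP.+-identityʳ x) (row 0 (s≤s z≤n)) ∷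
        Equivalence.from ih
          ( (λ j j<k → subst (λ x → Q (x , y)) (sym (x+1+j≡ j)) (row (suc j) (s≤s j<k)))
          , subst (λ x → All Q (vertices (x , y) P)) (sym (x+1+j≡ k)) rest)

  IncRuns-N∷E^k++ : ∀ w k {P : List (Step b)} → IncRuns P → (k ≡ 0 → IncRuns (N w ∷ P)) →
                    IncRuns (N w ∷ replicate k E ++ P)
  IncRuns-N∷E^k++ w zero    _   inc₀ = inc₀ refl
  IncRuns-N∷E^k++ w (suc k) inc _    = IncRuns-E^k++ k inc

  All-vertices⇒head : ∀ {Q : Pred Point ℓ} p (P : List (Step b)) → All Q (vertices p P) → Q p
  All-vertices⇒head p       []        (Qp ∷ _) = Qp
  All-vertices⇒head (x , y) (E ∷ P)   (Qp ∷ _) = Qp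
  All-vertices⇒head (x , y) (N _ ∷ P) (Qp ∷ _) = Qp

  hat-++E^e : ∀ e (P : List (Step b)) → hat e (P ++ replicate e E) ≡ replicate e E ++ P
  hat-++E^e e P = cong (replicate e E ++_) (begin
    take (length (P ++ replicate e E) ∸ e) (P ++ replicate e E) ≡⟨ cong (λ m → take m (P ++ replicate e E)) ∣P∣ ⟩
    take (length P) (P ++ replicate e E)                        ≡⟨ take-length-++ P (replicate e E) ⟩
    P                                                           ∎)
    where
      open ≡-Reasoning
      ∣P∣ : length (P ++ replicate e E) ∸ e ≡ length P
      ∣P∣ = trans (cong (_∸ e) (trans (length-++ P) (cong (λ m → length P + m) (length-replicate e))))
                  (m+n∸n≡m (length P) e)
      take-length-++ : ∀ (P Q : List (Step b)) → take (length P) (P ++ Q) ≡ P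
      take-length-++ []      Q = refl
      take-length-++ (s ∷ P) Q = cong (s ∷_) (take-length-++ P Q)

0≤level⇔ : ∀ a b x y → + 0 ℤ.≤ level a b (+ x , + y) ⇔ b * x ≤ a * y
0≤level⇔ a b x y =
  subst (λ z → + 0 ℤ.≤ z ⇔ b * x ≤ a * y) (cong₂ ℤ._-_ (ZP.pos-* a y) (ZP.pos-* b x)) 0≤+m-+k⇔k≤m

InTriangle-bottom : ∀ a b {e j} → e ≤ a → j ≤ e → InTriangle a b e (- + e ℤ.+ + j , + 0)
InTriangle-bottom a b {e} {j} e≤a j≤e =
  ℤ.+≤+ z≤n ,
  ZP.≤-trans (subst (- + e ℤ.+ + j ℤ.≤_) (ZP.+-inverseˡ (+ e)) (ZP.+-monoʳ-≤ (- + e) (ℤ.+≤+ j≤e)))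
             (subst (+ 0 ℤ.≤_) (sym (+m-+k≡+[m∸k] e≤a)) (ℤ.+≤+ z≤n)) ,
  subst₂ ℤ._≤_ (sym (ZP.*-zeroʳ (+ a))) (trans (ZP.pos-* b j) (cong (+ b ℤ.*_) (sym (-x+y+x≡y (+ e) (+ j)))))
               (ℤ.+≤+ z≤n)
  where
    -x+y+x≡y : ∀ x y → - x ℤ.+ y ℤ.+ x ≡ y
    -x+y+x≡y = ℤ-Solver.solve-∀

replicate-+ : ∀ {A : Set} m k (x : A) → replicate (m + k) x ≡ replicate m x ++ replicate k x
replicate-+ zero    k x = refl
replicate-+ (suc m) k x = cong (x ∷_) (replicate-+ m k x)

All-InTriangle-E^e++⇔ : ∀ a b {e} → e ≤ a → (P : List (Step b)) →
                        All (InTriangle a b e) (vertices (- + e , + 0) (replicate e E ++ P)) ⇔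
                        All (InTriangle a b e) (vertices (+ 0 , + 0) P)
All-InTriangle-E^e++⇔ a b {e} e≤a P = mk⇔
  (λ all → subst (λ x → All Tri (vertices (x , + 0) P)) (ZP.+-inverseˡ (+ e)) (proj₂ (Equivalence.to split all)))
  (λ all → Equivalence.from split
    ( (λ j j<e → InTriangle-bottom a b e≤a (<⇒≤ j<e))
    , subst (λ x → All Tri (vertices (x , + 0) P)) (sym (ZP.+-inverseˡ (+ e))) all))
  where
    Tri : Point → Set
    Tri = InTriangle a b e
    split : All Tri (vertices (- + e , + 0) (replicate e E ++ P)) ⇔
            ((∀ j → j < e → Tri (- + e ℤ.+ + j , + 0)) × All Tri (vertices (- + e ℤ.+ + e , + 0) P))
    split = All-vertices-E^k++ e (- + e) (+ 0) P

module LatticePathOf {b} (D : Config b) where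

  V : Fin b → ℕ
  V i = ℤ.∣ D i ∣

  Ascending : ℕ → ℕ → List (Fin b) → Set
  Ascending m cur []       = cur ≤ m
  Ascending m cur (w ∷ ws) = cur ≤ V w × Ascending m (V w) ws

  ascending : ∀ {R : Rel (Fin b) ℓ} {m cur ws} → (∀ {i j} → R i j → V i ≤ V j) → (∀ i → V i ≤ m) →
              AllPairs R ws → All (λ w → cur ≤ V w) ws → cur ≤ m → Ascending m cur ws
  ascending R⇒≤ V≤m []            []            cur≤m = cur≤m
  ascending R⇒≤ V≤m (w≺ws ∷ ws↑) (cur≤w ∷ _) _      = cur≤w , ascending R⇒≤ V≤m ws↑ (All.map R⇒≤ w≺ws) (V≤m _)

  Ascending⇒≤ : ∀ {m cur} ws → Ascending m cur ws → cur ≤ m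
  Ascending⇒≤ []       cur≤m           = cur≤m
  Ascending⇒≤ (w ∷ ws) (cur≤w , w≤…) = ≤-trans cur≤w (Ascending⇒≤ ws w≤…)

  lpathFrom-[] : ∀ m cur → lpathFrom m D cur [] ≡ replicate (m ∸ cur) E ++ []
  lpathFrom-[] m cur = sym (++-identityʳ _)

  labels-lpathFrom : ∀ m cur ws → labels (lpathFrom m D cur ws) ≡ ws
  labels-lpathFrom m cur []       = trans (cong labels (lpathFrom-[] m cur)) (labels-E^k++ (m ∸ cur) [])
  labels-lpathFrom m cur (w ∷ ws) = trans (labels-E^k++ (V w ∸ cur) _) (cong (w ∷_) (labels-lpathFrom m (V w) ws))

  countE-lpathFrom : ∀ {m cur} ws → Ascending m cur ws → countE (lpathFrom m D cur ws) ≡ m ∸ cur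
  countE-lpathFrom {m} {cur} [] _ =
    trans (cong countE (lpathFrom-[] m cur)) (trans (countE-E^k++ (m ∸ cur) []) (+-identityʳ _))
  countE-lpathFrom {m} {cur} (w ∷ ws) (cur≤w , w≤…) = begin
    countE (replicate (V w ∸ cur) E ++ N w ∷ lpathFrom m D (V w) ws)
      ≡⟨ countE-E^k++ (V w ∸ cur) _ ⟩
    (V w ∸ cur) + countE (lpathFrom m D (V w) ws)
      ≡⟨ cong (λ t → (V w ∸ cur) + t) (countE-lpathFrom ws w≤…) ⟩
    (V w ∸ cur) + (m ∸ V w)
      ≡⟨ +-∸-comm (m ∸ V w) cur≤w ⟨
    (V w + (m ∸ V w)) ∸ cur
      ≡⟨ cong (_∸ cur) (m+[n∸m]≡n (Ascending⇒≤ ws w≤…)) ⟩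
    m ∸ cur
      ∎
    where open ≡-Reasoning

  lpathFrom-+ : ∀ {m cur} k ws → Ascending m cur ws →
                lpathFrom (m + k) D cur ws ≡ lpathFrom m D cur ws ++ replicate k E
  lpathFrom-+ {m} {cur} k [] cur≤m =
    trans (cong (λ j → replicate j E) (+-∸-comm k cur≤m)) (replicate-+ (m ∸ cur) k E)
  lpathFrom-+ {m} {cur} k (w ∷ ws) (_ , w≤…) =
    trans (cong (λ P → replicate (V w ∸ cur) E ++ N w ∷ P) (lpathFrom-+ k ws w≤…))
          (sym (++-assoc (replicate (V w ∸ cur) E) (N w ∷ lpathFrom m D (V w) ws) (replicate k E)))

  IncRuns-lpathFrom : ∀ {R : Rel (Fin b) ℓ} → (∀ {i j} → R i j → V i ≡ V j → i Fin.< j) →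
                      ∀ {m cur} ws → AllPairs R ws → Ascending m cur ws → IncRuns (lpathFrom m D cur ws)
  IncRuns-lpathFrom {R = R} tiebreak = go
    where
      after : ∀ {m} w ws → AllPairs R (w ∷ ws) → Ascending m (V w) ws → IncRuns (N w ∷ lpathFrom m D (V w) ws)
      after {m} w [] _ _ =
        subst (λ P → IncRuns (N w ∷ P)) (sym (lpathFrom-[] m (V w))) (IncRuns-N∷E^k++ w (m ∸ V w) tt (λ _ → tt))
      after w (w′ ∷ ws) ((wRw′ ∷ _) ∷ ws↑) (w≤w′ , w′≤…) =
        IncRuns-N∷E^k++ w (V w′ ∸ V w) rest (λ w′∸w≡0 → tiebreak wRw′ (≤-antisym w≤w′ (m∸n≡0⇒m≤n w′∸w≡0)) , rest)
        where rest = after w′ ws ws↑ w′≤…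

      go : ∀ {m cur} ws → AllPairs R ws → Ascending m cur ws → IncRuns (lpathFrom m D cur ws)
      go {m} {cur} []       _    _          = subst IncRuns (sym (lpathFrom-[] m cur)) (IncRuns-E^k++ (m ∸ cur) tt)
      go {cur = cur} (w ∷ ws) ws↑ (_ , w≤…) = IncRuns-E^k++ (V w ∸ cur) (after w ws ws↑ w≤…)

  private
    east-run-end : ∀ {cur v} → cur ≤ v → + cur ℤ.+ + (v ∸ cur) ≡ + v
    east-run-end cur≤v = cong +_ (m+[n∸m]≡n cur≤v)

    north-step-end : ∀ y → + y ℤ.+ + 1 ≡ + suc y
    north-step-end y = cong +_ (+-comm y 1)

  All-northStarts-lpathFrom⇔ : ∀ {Q : Point → Set} {m cur} y ws → Ascending m cur ws →
    All Q (northStarts (+ cur , + y) (lpathFrom m D cur ws)) ⇔ AllFrom (λ k w → Q (+ V w , + k)) y ws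
  All-northStarts-lpathFrom⇔ {Q = Q} {m} {cur} y [] _ =
    mk⇔ (λ _ → tt) (λ _ → subst (All Q) (sym none) [])
    where
      none : northStarts (+ cur , + y) (lpathFrom m D cur []) ≡ []
      none = trans (cong (northStarts _) (lpathFrom-[] m cur)) (northStarts-E^k++ (m ∸ cur) (+ cur) (+ y) [])
  All-northStarts-lpathFrom⇔ {Q = Q} {m} {cur} y (w ∷ ws) (cur≤w , w≤…) =
    subst (λ ps → All Q ps ⇔ AllFrom (λ k w → Q (+ V w , + k)) y (w ∷ ws)) (sym first-north-step)
      (mk⇔ (λ { (q ∷ qs) → q , Equivalence.to ih qs }) (λ (q , qs) → q ∷ Equivalence.from ih qs))
    where
      ih : All Q (northStarts (+ V w , + suc y) (lpathFrom m D (V w) ws)) ⇔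
           AllFrom (λ k w → Q (+ V w , + k)) (suc y) ws
      ih = All-northStarts-lpathFrom⇔ (suc y) ws w≤…
      first-north-step : northStarts (+ cur , + y) (lpathFrom m D cur (w ∷ ws)) ≡
                         (+ V w , + y) ∷ northStarts (+ V w , + suc y) (lpathFrom m D (V w) ws)
      first-north-step = trans (northStarts-E^k++ (V w ∸ cur) (+ cur) (+ y) _)
        (cong₂ (λ x y′ → (x , + y) ∷ northStarts (x , y′) (lpathFrom m D (V w) ws))
               (east-run-end cur≤w) (north-step-end y))

  NorthTopsInside : (a e : ℕ) → ℕ → List (Fin b) → Set
  NorthTopsInside a e = AllFrom (λ k w → a * suc k ≤ b * (V w + e))

  module _ {a e m : ℕ} (e≤a : e ≤ a) (m≤a∸e : m ≤ a ∸ e) where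

    private
      Tri : Point → Set
      Tri = InTriangle a b e

      Tri⁺ : ∀ {x y} → x ≤ a ∸ e → a * y ≤ b * (x + e) → Tri (+ x , + y)
      Tri⁺ {x} {y} x≤a∸e ay≤ = ℤ.+≤+ z≤n , subst (+ x ℤ.≤_) (sym (+m-+k≡+[m∸k] e≤a)) (ℤ.+≤+ x≤a∸e) ,
                               subst₂ ℤ._≤_ (ZP.pos-* a y) (ZP.pos-* b (x + e)) (ℤ.+≤+ ay≤)

      Tri⁻ : ∀ {x y} → Tri (+ x , + y) → a * y ≤ b * (x + e)
      Tri⁻ {x} {y} (_ , _ , ay≤) = ZP.drop‿+≤+ (subst₂ ℤ._≤_ (sym (ZP.pos-* a y)) (sym (ZP.pos-* b (x + e))) ay≤)

      row : ∀ {cur x y} → a * y ≤ b * (cur + e) → cur ≤ x → x ≤ m → Tri (+ x , + y)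
      row ay≤ cur≤x x≤m = Tri⁺ (≤-trans x≤m m≤a∸e) (≤-trans ay≤ (*-monoʳ-≤ b (+-monoˡ-≤ e cur≤x)))

      east-run : ∀ {cur y} k → a * y ≤ b * (cur + e) → cur + k ≤ m → ∀ j → j < k → Tri (+ cur ℤ.+ + j , + y)
      east-run {cur} k ay≤ cur+k≤m j j<k = row ay≤ (m≤m+n cur j) (≤-trans (+-monoʳ-≤ cur (<⇒≤ j<k)) cur+k≤m)

      All-vertices-first-run⇔ : ∀ {cur y w} ws → cur ≤ V w →
        All Tri (vertices (+ cur , + y) (lpathFrom m D cur (w ∷ ws))) ⇔
        ((∀ j → j < V w ∸ cur → Tri (+ cur ℤ.+ + j , + y)) ×
         All Tri (vertices (+ V w , + y) (N w ∷ lpathFrom m D (V w) ws)))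
      All-vertices-first-run⇔ {cur} {y} {w} ws cur≤w =
        subst (λ x → All Tri (vertices (+ cur , + y) (lpathFrom m D cur (w ∷ ws))) ⇔
                     ((∀ j → j < V w ∸ cur → Tri (+ cur ℤ.+ + j , + y)) ×
                      All Tri (vertices (x , + y) (N w ∷ lpathFrom m D (V w) ws))))
              (east-run-end cur≤w)
              (All-vertices-E^k++ (V w ∸ cur) (+ cur) (+ y) (N w ∷ lpathFrom m D (V w) ws))

    All-vertices-lpathFrom⇔ : ∀ {cur} y ws → Ascending m cur ws → a * y ≤ b * (cur + e) →
      All Tri (vertices (+ cur , + y) (lpathFrom m D cur ws)) ⇔ NorthTopsInside a e y ws
    All-vertices-lpathFrom⇔ {cur} y [] cur≤m ay≤ = mk⇔ (λ _ → tt) (λ _ →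
      subst (λ P → All Tri (vertices (+ cur , + y) P)) (sym (lpathFrom-[] m cur))
        (Equivalence.from (All-vertices-E^k++ (m ∸ cur) (+ cur) (+ y) [])
          (east-run (m ∸ cur) ay≤ cur+[m∸cur]≤m , row ay≤ (m≤m+n cur _) cur+[m∸cur]≤m ∷ [])))
      where
        cur+[m∸cur]≤m : cur + (m ∸ cur) ≤ m
        cur+[m∸cur]≤m = ≤-reflexive (m+[n∸m]≡n cur≤m)
    All-vertices-lpathFrom⇔ {cur} y (w ∷ ws) (cur≤w , w≤…) ay≤ = mk⇔ to from
      where
        rest : List (Step b)
        rest = lpathFrom m D (V w) ws
        w≤m : V w ≤ m
        w≤m = Ascending⇒≤ ws w≤…
        ih : a * suc y ≤ b * (V w + e) →
             All Tri (vertices (+ V w , + suc y) rest) ⇔ NorthTopsInside a e (suc y) ws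
        ih = All-vertices-lpathFrom⇔ (suc y) ws w≤…

        above≡ : vertices (+ V w , + y ℤ.+ + 1) rest ≡ vertices (+ V w , + suc y) rest
        above≡ = cong (λ y′ → vertices (+ V w , y′) rest) (north-step-end y)

        to : All Tri (vertices (+ cur , + y) (lpathFrom m D cur (w ∷ ws))) → NorthTopsInside a e y (w ∷ ws)
        to all with Equivalence.to (All-vertices-first-run⇔ ws cur≤w) all
        ... | _ , (_ ∷ above) = top , Equivalence.to (ih top) above′
          where
            above′ : All Tri (vertices (+ V w , + suc y) rest)
            above′ = subst (All Tri) above≡ above
            top : a * suc y ≤ b * (V w + e)
            top = Tri⁻ (All-vertices⇒head _ rest above′)

        from : NorthTopsInside a e y (w ∷ ws) → All Tri (vertices (+ cur , + y) (lpathFrom m D cur (w ∷ ws)))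
        from (top , tops) = Equivalence.from (All-vertices-first-run⇔ ws cur≤w)
          ( east-run (V w ∸ cur) ay≤ (≤-trans (≤-reflexive (m+[n∸m]≡n cur≤w)) w≤m)
          , row ay≤ cur≤w w≤m ∷ subst (All Tri) (sym above≡) (Equivalence.from (ih top) tops))

module Characterisations (a n : ℕ) (1≤n : 1 ≤ n) (coprime : Coprime a (suc n)) where

  open FloorDivision a n
  open ChipFiring a n
  open FlipCorrespondence a n 1≤n coprime public

  M≤a : M ≤ a
  M≤a = subst (M ≤_) (M+e≡a 1≤n coprime) (m≤m+n M e)

  module _ {D : Config b} (D-stable : Stable a b 0 D) where
    open Poorer D
    open LatticePathOf D

    private
      ws : List (Fin b)
      ws = sortedVertices D
      D≥0 : NonNeg D
      D≥0 = proj₁ (Equivalence.to stable₀⇔bounded D-stable)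
      D≤M : ∀ i → ℤ.∣ D i ∣ ≤ M
      D≤M = proj₂ (Equivalence.to stable₀⇔bounded D-stable)

      ascending-to : ∀ m → M ≤ m → Ascending m 0 ws
      ascending-to m M≤m =
        ascending (≺⇒∣≤∣ D≥0) (λ i → ≤-trans (D≤M i) M≤m) sortedVertices-sorted (All.tabulate (λ _ → z≤n)) z≤n

      ∣ws∣≡b : length ws ≡ b
      ∣ws∣≡b = trans (↭-length sortedVertices-↭) (length-tabulate (λ i → i))

      ∀<∣ws∣⇔∀<b : ∀ {R : ℕ → Set} → (∀ k → k < length ws → R k) ⇔ (∀ k → k < b → R k)
      ∀<∣ws∣⇔∀<b = mk⇔ (λ Rₖ k k<b → Rₖ k (subst (k <_) (sym ∣ws∣≡b) k<b))
                        (λ Rₖ k k<∣ws∣ → Rₖ k (subst (k <_) ∣ws∣≡b k<∣ws∣))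

      position : ∀ {Q : Pred (Fin b) 0ℓ} (Q? : Decidable₁ Q) → (∀ {x y} → x ≺ y → Q y → Q x) →
                 ∀ k (k<∣ws∣ : k < length ws) → Q (List.lookup ws (fromℕ< k<∣ws∣)) ⇔ k < ∣ subsetOf Q? ∣
      position Q? Q-down = lookup⇔<∣subsetOf∣ Q? Q-down sortedVertices-↭ sortedVertices-sorted

    lpath-labeled : LabeledPath a b (lpath a D)
    lpath-labeled = countE-lpathFrom ws (ascending-to a M≤a) ,
                    subst (_↭ allFin b) (sym (labels-lpathFrom a 0 ws)) sortedVertices-↭ ,
                    IncRuns-lpathFrom (≺-tiebreak D≥0) ws sortedVertices-sorted (ascending-to a M≤a)

    private
      dyck-at⇔ : ∀ k (k<∣ws∣ : k < length ws) → let w = List.lookup ws (fromℕ< k<∣ws∣) in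
                 + 0 ℤ.≤ level a b (+ V w , + k) ⇔ k < ∣ atMost D (c k) ∣
      dyck-at⇔ k k<∣ws∣ = begin
        + 0 ℤ.≤ level a b (+ V w , + k) ≈⟨ 0≤level⇔ a b (V w) k ⟩
        b * V w ≤ a * k                 ≈⟨ ⇔-sym ≤c⇔ ⟩
        V w ≤ c k                       ≈⟨ position (λ i → V i ≤? c k) (≤-trans ∘ ≺⇒∣≤∣ D≥0) k k<∣ws∣ ⟩
        k < ∣ atMost D (c k) ∣          ∎
        where
          open ⇔-Reasoning
          w : Fin b
          w = List.lookup ws (fromℕ< k<∣ws∣)

    dyck⇔superstableCounts : All (λ p → + 0 ℤ.≤ level a b p) (northStarts (+ 0 , + 0) (lpath a D)) ⇔
                             SuperstableCounts D
    dyck⇔superstableCounts = begin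
      All (λ p → + 0 ℤ.≤ level a b p) (northStarts (+ 0 , + 0) (lpath a D))
        ≈⟨ All-northStarts-lpathFrom⇔ 0 ws (ascending-to a M≤a) ⟩
      AllFrom (λ k w → + 0 ℤ.≤ level a b (+ V w , + k)) 0 ws
        ≈⟨ AllFrom⇔∀ ws dyck-at⇔ ⟩
      (∀ k → k < length ws → k < ∣ atMost D (c k) ∣)
        ≈⟨ ∀<∣ws∣⇔∀<b ⟩
      SuperstableCounts D
        ∎
      where open ⇔-Reasoning

    skeletal-top⇔dyck : Skeletal a b (b ∸ 1) D ⇔ IsLabeledDyck a b (lpath a D)
    skeletal-top⇔dyck = mk⇔
      (λ (D-super , _) → lpath-labeled , Equivalence.from dyck⇔superstableCounts (superstable⇒counts D-super))
      (λ (_ , dyck) → superstable⇒skeletal (counts⇒superstable D≥0 (Equivalence.to dyck⇔superstableCounts dyck)))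

    private
      Q : List (Step b)
      Q = lpathFrom M D 0 ws

      e≤a : e ≤ a
      e≤a = subst (e ≤_) (M+e≡a 1≤n coprime) (m≤n+m e M)

      M≤a∸e : M ≤ a ∸ e
      M≤a∸e = ≤-reflexive (sym (subst (λ a → a ∸ e ≡ M) (M+e≡a 1≤n coprime) (m+n∸n≡m M e)))

    hat-lpath : hat (eOf a b) (lpath a D) ≡ replicate e E ++ Q
    hat-lpath = trans (cong (hat e) (begin
      lpathFrom a D 0 ws             ≡⟨ cong (λ m → lpathFrom m D 0 ws) (sym (M+e≡a 1≤n coprime)) ⟩
      lpathFrom (M + e) D 0 ws       ≡⟨ lpathFrom-+ e ws (ascending-to M ≤-refl) ⟩
      Q ++ replicate e E             ∎)) (hat-++E^e e Q)
      where open ≡-Reasoning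

    hat-labeled : LabeledPath a b (replicate e E ++ Q)
    hat-labeled =
      trans (countE-E^k++ e Q) (trans (cong (λ t → e + t) (countE-lpathFrom ws (ascending-to M ≤-refl)))
                                      (trans (+-comm e M) (M+e≡a 1≤n coprime))) ,
      subst (_↭ allFin b) (sym (trans (labels-E^k++ e Q) (labels-lpathFrom M 0 ws))) sortedVertices-↭ ,
      IncRuns-E^k++ e (IncRuns-lpathFrom (≺-tiebreak D≥0) ws sortedVertices-sorted (ascending-to M ≤-refl))

    private
      inverted-at⇔ : ∀ k (k<∣ws∣ : k < length ws) → let w = List.lookup ws (fromℕ< k<∣ws∣) in
                     a * suc k ≤ b * (V w + e) ⇔ ∣ canBorrow D (suc k) ∣ < suc k
      inverted-at⇔ k k<∣ws∣ = begin
        a * suc k ≤ b * (V w + e)                ≈⟨ ⇔-sym (top-of-north-step⇔ 1≤n coprime (V w) k k≤n) ⟩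
        M ≤ V w + c (n ∸ k)                      ≈⟨ ⇔-sym ≰+suc⇔≥+ ⟩
        (¬ V w + suc (c (n ∸ k)) ≤ M)
          ≈⟨ ¬-cong-⇔ (position (λ i → V i + suc (c (n ∸ k)) ≤? M) down k k<∣ws∣) ⟩
        (¬ k < ∣ canBorrow D (suc k) ∣)
          ≈⟨ mk⇔ (s≤s ∘ ≮⇒≥) (λ ∣G∣<1+k k<∣G∣ → <⇒≱ k<∣G∣ (≤-pred ∣G∣<1+k)) ⟩
        ∣ canBorrow D (suc k) ∣ < suc k          ∎
        where
          open ⇔-Reasoning
          w : Fin b
          w = List.lookup ws (fromℕ< k<∣ws∣)
          k≤n : k ≤ n
          k≤n = ≤-pred (subst (k <_) ∣ws∣≡b k<∣ws∣)
          down : ∀ {x y} → x ≺ y → V y + suc (c (n ∸ k)) ≤ M → V x + suc (c (n ∸ k)) ≤ M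
          down x≺y = ≤-trans (+-monoˡ-≤ _ (≺⇒∣≤∣ D≥0 x≺y))

    inverted⇔skeletalCounts : All (InTriangle a b e) (vertices (- + e , + 0) (replicate e E ++ Q)) ⇔
                              SkeletalCounts D
    inverted⇔skeletalCounts = begin
      All (InTriangle a b e) (vertices (- + e , + 0) (replicate e E ++ Q))
        ≈⟨ All-InTriangle-E^e++⇔ a b e≤a Q ⟩
      All (InTriangle a b e) (vertices (+ 0 , + 0) Q)
        ≈⟨ All-vertices-lpathFrom⇔ e≤a M≤a∸e 0 ws (ascending-to M ≤-refl)
                                   (subst (_≤ b * e) (sym (*-zeroʳ a)) z≤n) ⟩
      NorthTopsInside a e 0 ws
        ≈⟨ AllFrom⇔∀ ws inverted-at⇔ ⟩
      (∀ k → k < length ws → ∣ canBorrow D (suc k) ∣ < suc k)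
        ≈⟨ ∀<∣ws∣⇔∀<b ⟩
      (∀ k → k < b → ∣ canBorrow D (suc k) ∣ < suc k)
        ≈⟨ mk⇔ (λ counts → λ { (suc k) _ 1+k≤b → counts k 1+k≤b })
               (λ counts k k<b → counts (suc k) (s≤s z≤n) k<b) ⟩
      SkeletalCounts D
        ∎
      where open ⇔-Reasoning

    skeletal₀⇔inverted : Skeletal a b 0 D ⇔ IsLabeledInvDyck a b (hat (eOf a b) (lpath a D))
    skeletal₀⇔inverted = subst (λ P → Skeletal a b 0 D ⇔ IsLabeledInvDyck a b P) (sym hat-lpath) (mk⇔
      (λ D-skeletal → hat-labeled , Equivalence.from inverted⇔skeletalCounts (skeletal₀⇒counts D-skeletal))
      (λ (_ , inverted) → counts⇒skeletal₀ D-stable (Equivalence.to inverted⇔skeletalCounts inverted)))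

theorem4p10 : (a b : ℕ) → 0 < a → 1 < b → Coprime a b →
    -- (a)
    ((D : Config b) → Stable a b 0 D →
       (Skeletal a b (b ∸ 1) D ⇔ IsLabeledDyck a b (lpath a D)))
    -- (b)
    × ((D : Config b) → Stable a b 0 D →
       (Skeletal a b 0 D ⇔ IsLabeledInvDyck a b (hat (eOf a b) (lpath a D))))
    -- (c) D ↦ a - e - D is a bijection {superstable} → {0-skeletal}
    × (((D : Config b) → Superstable a b D → Skeletal a b 0 (flipConfig a b D))
      × ((D₁ D₂ : Config b) → Superstable a b D₁ → Superstable a b D₂ →
           (∀ i → flipConfig a b D₁ i ≡ flipConfig a b D₂ i) → ∀ i → D₁ i ≡ D₂ i)
      × ((D′ : Config b) → Skeletal a b 0 D′ →
           Σ (Config b) (λ D → Superstable a b D × (∀ i → flipConfig a b D i ≡ D′ i))))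
theorem4p10 a (suc n) _ (s≤s 1≤n) coprime =
  (λ _ → skeletal-top⇔dyck) ,
  (λ _ → skeletal₀⇔inverted) ,
  ( (λ _ → superstable⇒flip-skeletal₀)
  , (λ D₁ D₂ _ _ flip≡ i → flipConfig-injective a (suc n) D₁ D₂ i (flip≡ i))
  , (λ D′ D′-skeletal →
       flipConfig a (suc n) D′ , skeletal₀⇒flip-superstable D′-skeletal , flipConfig-involutive a (suc n) D′))
  where open Characterisations a n 1≤n coprime
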